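{- Let $T$ be a decision tree of depth $d$ all of whose leaf labels are real constants (degree at most $0$), computing $f\colon\{ -1,1\}^n\to\mathbb R$. Then $L_kf=T|_{\mathcal P_{d,k}}$ for $k=0,1,2,\dots,n$.
   Context: A decision tree of depth $d$ in variables $x_1,\dots,x_n\in\{ -1,1\}$ is a function $T$ on strings $v\in\{ -1,1\}^{\le d}$ such that for $|v|\le d-1$, $T(v)\in\{1,\dots,n\}$ is the index of the variable queried at node $v$, with $T(\varepsilon),T(v_1),\dots,T(v_1\cdots v_{d-1})$ pairwise distinct for each $v\in\{ -1,1\}^{d-1}$; each leaf $v\in\{ -1,1\}^d$ has label $T(v)$. It computes $f(x)=\sum_{v\in\{ -1,1\}^d}T(v)\prod_{i=1}^d\frac{1+v_ix_{T(v_1\cdots v_{i-1})}}{2}$. $\mathcal P_{d,k}$ is the family of $k$-subsets of $\{1,\dots,d\}$. For a family $\mathcal S$ of subsets of $\{1,\dots,d\}$, $T|_{\mathcal S}(x)=\sum_{S\in\mathcal S}\sum_{v\in\{ -1,1\}^d}T(v)\,2^{ -d}\prod_{i\in S}v_ix_{T(v_1\cdots v_{i-1})}$. For $\phi\colon\{ -1,1\}^n\to\mathbb R$ with Fourier expansion $\sum_S\hat\phi(S)\prod_{i\in S}x_i$, $L_k\phi=\sum_{|S|=k}\hat\phi(S)\prod_{i\in S}x_i$. -}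

module Defs where

open import Level using (Level)
open import Data.Nat using (ℕ; zero; suc; _≟_)
open import Data.Fin using (Fin; zero; suc)
open import Data.Vec using (Vec; []; _∷_; lookup)
open import Data.List using (List; []; _∷_; _++_; map; foldr; filter; concatMap)
open import Data.Sign using (Sign)
open import Data.Bool using (if_then_else_)
open import Data.Fin.Subset using (Subset; ∣_∣)
open import Relation.Binary.PropositionalEquality using (_≡_)
open import Algebra.Bundles using (CommutativeRing)

private variable
  a : Level

-- A node queries a variable; the subtree
-- `onMinus` is followed when the queried variable is -1, `onPlus` when +1.
-- Every leaf is at depth exactly d.

data DTree (A : Set a) (n : ℕ) : ℕ → Set a where
  leaf : A → DTree A n 0
  node : ∀ {d} → Fin n → (onMinus onPlus : DTree A n d) → DTree A n (suc d)

child : ∀ {A : Set a} {n d} → Sign → DTree A n (suc d) → DTree A n d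
child Sign.- (node _ m _) = m
child Sign.+ (node _ _ p) = p

label : ∀ {A : Set a} {n d} → DTree A n d → Vec Sign d → A
label (leaf r) [] = r
label t@(node _ _ _) (s ∷ v) = label (child s t) v

-- query T v i = T(v_1 ⋯ v_{i-1}) (i 0-indexed: the variable queried at the
-- i-th node along the path v)
query : ∀ {A : Set a} {n d} → DTree A n d → Vec Sign d → Fin d → Fin n
query (node i _ _) (s ∷ v) zero = i
query t@(node _ _ _) (s ∷ v) (suc j) = query (child s t) v j

Distinct : ∀ {A : Set a} {n d} → DTree A n d → Set
Distinct {d = d} T = ∀ (v : Vec Sign d) (i j : Fin d) → query T v i ≡ query T v j → i ≡ j

allVecs : ∀ {A : Set a} → List A → (m : ℕ) → List (Vec A m)
allVecs xs zero = [] ∷ []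
allVecs xs (suc m) = concatMap (λ x → map (x ∷_) (allVecs xs m)) xs

allSigns : (m : ℕ) → List (Vec Sign m)
allSigns = allVecs (Sign.- ∷ Sign.+ ∷ [])

allSubsets : (m : ℕ) → List (Subset m)
allSubsets = allVecs (Data.Bool.false ∷ Data.Bool.true ∷ [])

P : (d k : ℕ) → List (Subset d)
P d k = filter (λ S → ∣ S ∣ ≟ k) (allSubsets d)

-- Ring-valued notions.  `half` is meant to be 1/2 (half + half ≈ 1).

module _ {c ℓ} (R : CommutativeRing c ℓ) where
  open CommutativeRing R using (Carrier; _+_; _*_; -_; 0#; 1#)

  Σ[_]_ : ∀ {B : Set a} → List B → (B → Carrier) → Carrier
  Σ[ xs ] f = foldr (λ x acc → f x + acc) 0# xs

  Π-Fin : (m : ℕ) → (Fin m → Carrier) → Carrier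
  Π-Fin zero f = 1#
  Π-Fin (suc m) f = f zero * Π-Fin m (λ i → f (suc i))

  pow : Carrier → ℕ → Carrier
  pow x zero = 1#
  pow x (suc m) = x * pow x m

  sgn : Sign → Carrier
  sgn Sign.+ = 1#
  sgn Sign.- = - 1#

  Cube : ℕ → Set c
  Cube n = Vec Sign n → Carrier

  eval : (half : Carrier) → ∀ {n d} → DTree Carrier n d → Cube n
  eval half {n} {d} T x =
    Σ[ allSigns d ] λ v → label T v *
      Π-Fin d (λ i → (1# + sgn (lookup v i) * sgn (lookup x (query T v i))) * half)

  restrict : (half : Carrier) → ∀ {n d} → DTree Carrier n d → List (Subset d) → Cube n
  restrict half {n} {d} T 𝒮 x =
    Σ[ 𝒮 ] λ S → Σ[ allSigns d ] λ v → label T v * pow half d *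
      Π-Fin d (λ i → if lookup S i
                      then sgn (lookup v i) * sgn (lookup x (query T v i))
                      else 1#)

  χ : ∀ {n} → Subset n → Cube n
  χ {n} S x = Π-Fin n (λ i → if lookup S i then sgn (lookup x i) else 1#)

  coeff : (half : Carrier) → ∀ {n} → Cube n → Subset n → Carrier
  coeff half {n} φ S = pow half n * Σ[ allSigns n ] (λ x → φ x * χ S x)

  L : (half : Carrier) → ∀ {n} → ℕ → Cube n → Cube n
  L half {n} k φ x = Σ[ P n k ] λ S → coeff half φ S * χ S x

-- Expanding each product ∏ᵢ (1 + vᵢ x_{qᵢ})/2 turns f into 2^{-d} Σ_v Σ_S T(v) ∏_{i∈S} vᵢ x_{qᵢ},
-- and since the variables q₁, …, q_d queried along a path are distinct, the monomial indexed
-- by S ⊆ {1,…,d} is ± the character of the |S|-element set q(S). The operator L_k is linear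
-- and, by orthogonality of characters, keeps exactly the characters of degree k; so it keeps
-- exactly the terms with |S| = k, which is T|_{𝒫_{d,k}}.
module Submission where

open import Defs
open import Data.Nat using (ℕ; zero; suc; _≤_; _≟_)
open import Data.Fin using (Fin; zero; suc)
open import Data.Fin.Properties using (suc-injective)
open import Data.Fin.Subset using (Subset; ∣_∣; ⊥; inside; outside; _∈_; _∉_)
open import Data.Fin.Subset.Properties using (∉⊥; ∣⊥∣≡0)
open import Data.Vec using (Vec; []; _∷_; lookup; here; there; _[_]≔_)
open import Data.Vec.Properties using (∷-injectiveʳ)
open import Data.List using (List; []; _∷_; _++_; map; filter)
open import Data.Sign using (Sign)
open import Data.Bool using (Bool; true; false; if_then_else_)
open import Data.Product using (∃; _,_)
open import Data.Sum as Sum using (_⊎_; inj₁; inj₂)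
open import Function using (_∘_)
open import Function.Definitions using (Injective)
open import Relation.Nullary using (does; contradiction)
open import Relation.Unary using (Decidable)
open import Relation.Binary.PropositionalEquality as ≡ using (_≡_; _≢_)
open import Algebra.Bundles using (CommutativeRing)
import Algebra.Properties.CommutativeSemigroup as CommutativeSemigroupProperties
import Algebra.Properties.Ring as RingProperties
import Relation.Binary.Reasoning.Setoid as SetoidReasoning

module Image where

  insert : ∀ {n} → Fin n → Subset n → Subset n
  insert x p = p [ x ]≔ inside

  image : ∀ {d n} → (Fin d → Fin n) → Subset d → Subset n
  image q [] = ⊥
  image q (outside ∷ S) = image (q ∘ suc) S
  image q (inside ∷ S) = insert (q zero) (image (q ∘ suc) S)

  injective-∘suc : ∀ {d n} {q : Fin (suc d) → Fin n} →
                   Injective _≡_ _≡_ q → Injective _≡_ _≡_ (q ∘ suc)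
  injective-∘suc q-inj e = suc-injective (q-inj e)

  ∈-insert⁻ : ∀ {n} (x : Fin n) (p : Subset n) {j} → j ∈ insert x p → j ≡ x ⊎ j ∈ p
  ∈-insert⁻ zero    (b ∷ p) here       = inj₁ ≡.refl
  ∈-insert⁻ zero    (b ∷ p) (there j∈) = inj₂ (there j∈)
  ∈-insert⁻ (suc x) (b ∷ p) here       = inj₂ here
  ∈-insert⁻ (suc x) (b ∷ p) (there j∈) = Sum.map (≡.cong suc) there (∈-insert⁻ x p j∈)

  ∈-image⁻ : ∀ {d n} (q : Fin d → Fin n) (S : Subset d) {j} → j ∈ image q S → ∃ λ i → q i ≡ j
  ∈-image⁻ q []            j∈ = contradiction j∈ ∉⊥
  ∈-image⁻ q (outside ∷ S) j∈ with ∈-image⁻ (q ∘ suc) S j∈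
  ... | i , qi≡j = suc i , qi≡j
  ∈-image⁻ q (inside ∷ S)  j∈ with ∈-insert⁻ (q zero) (image (q ∘ suc) S) j∈
  ... | inj₁ j≡q0 = zero , ≡.sym j≡q0
  ... | inj₂ j∈′ with ∈-image⁻ (q ∘ suc) S j∈′
  ...   | i , qi≡j = suc i , qi≡j

  head∉image-tail : ∀ {d n} {q : Fin (suc d) → Fin n} → Injective _≡_ _≡_ q →
                    (S : Subset d) → q zero ∉ image (q ∘ suc) S
  head∉image-tail q-inj S q0∈ with ∈-image⁻ _ S q0∈
  ... | i , qi≡q0 with q-inj qi≡q0
  ...   | ()

  ∣insert∣ : ∀ {n} (x : Fin n) (p : Subset n) → x ∉ p → ∣ insert x p ∣ ≡ suc ∣ p ∣
  ∣insert∣ zero    (outside ∷ p) _   = ≡.refl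
  ∣insert∣ zero    (inside ∷ p)  x∉p = contradiction here x∉p
  ∣insert∣ (suc x) (outside ∷ p) x∉p = ∣insert∣ x p (x∉p ∘ there)
  ∣insert∣ (suc x) (inside ∷ p)  x∉p = ≡.cong suc (∣insert∣ x p (x∉p ∘ there))

  ∣image∣ : ∀ {d n} {q : Fin d → Fin n} → Injective _≡_ _≡_ q → (S : Subset d) →
            ∣ image q S ∣ ≡ ∣ S ∣
  ∣image∣ {n = n} _ []   = ∣⊥∣≡0 n
  ∣image∣ q-inj (outside ∷ S) = ∣image∣ (injective-∘suc q-inj) S
  ∣image∣ q-inj (inside ∷ S)  =
    ≡.trans (∣insert∣ _ _ (head∉image-tail q-inj S))
            (≡.cong suc (∣image∣ (injective-∘suc q-inj) S))

open Image

module SumsAndProducts {c ℓ} (R : CommutativeRing c ℓ) where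

  open CommutativeRing R hiding (zero)
  open CommutativeSemigroupProperties *-commutativeSemigroup using (x∙yz≈y∙xz)
    renaming (interchange to *-interchange)
  open CommutativeSemigroupProperties +-commutativeSemigroup using ()
    renaming (interchange to +-interchange)

  ∑[_]_ : ∀ {a} {B : Set a} → List B → (B → Carrier) → Carrier
  ∑[_]_ = Σ[_]_ R

  ∑-cong : ∀ {a} {B : Set a} (xs : List B) {f g : B → Carrier} →
           (∀ b → f b ≈ g b) → ∑[ xs ] f ≈ ∑[ xs ] g
  ∑-cong []       f≈g = refl
  ∑-cong (x ∷ xs) f≈g = +-cong (f≈g x) (∑-cong xs f≈g)

  ∑-zero : ∀ {a} {B : Set a} (xs : List B) {f : B → Carrier} →
           (∀ b → f b ≈ 0#) → ∑[ xs ] f ≈ 0#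
  ∑-zero []       f≈0 = refl
  ∑-zero (x ∷ xs) f≈0 = trans (+-cong (f≈0 x) (∑-zero xs f≈0)) (+-identityˡ 0#)

  ∑-++ : ∀ {a} {B : Set a} (xs ys : List B) (f : B → Carrier) →
         ∑[ xs ++ ys ] f ≈ ∑[ xs ] f + ∑[ ys ] f
  ∑-++ []       ys f = sym (+-identityˡ _)
  ∑-++ (x ∷ xs) ys f = trans (+-cong refl (∑-++ xs ys f)) (sym (+-assoc _ _ _))

  ∑-map : ∀ {a b} {B : Set a} {C : Set b} (h : B → C) (xs : List B) (f : C → Carrier) →
          ∑[ map h xs ] f ≈ ∑[ xs ] (f ∘ h)
  ∑-map h []       f = refl
  ∑-map h (x ∷ xs) f = +-cong refl (∑-map h xs f)

  ∑-+ : ∀ {a} {B : Set a} (xs : List B) (f g : B → Carrier) →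
        ∑[ xs ] (λ b → f b + g b) ≈ ∑[ xs ] f + ∑[ xs ] g
  ∑-+ []       f g = sym (+-identityˡ 0#)
  ∑-+ (x ∷ xs) f g = trans (+-cong refl (∑-+ xs f g)) (+-interchange _ _ _ _)

  ∑-*ˡ : ∀ {a} {B : Set a} (xs : List B) (z : Carrier) (f : B → Carrier) →
         z * ∑[ xs ] f ≈ ∑[ xs ] (λ b → z * f b)
  ∑-*ˡ []       z f = zeroʳ z
  ∑-*ˡ (x ∷ xs) z f = trans (distribˡ _ _ _) (+-cong refl (∑-*ˡ xs z f))

  ∑-*ʳ : ∀ {a} {B : Set a} (xs : List B) (z : Carrier) (f : B → Carrier) →
         ∑[ xs ] f * z ≈ ∑[ xs ] (λ b → f b * z)
  ∑-*ʳ xs z f = trans (*-comm _ z) (trans (∑-*ˡ xs z f) (∑-cong xs (λ b → *-comm z (f b))))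

  ∑-swap : ∀ {a b} {B : Set a} {C : Set b} (xs : List B) (ys : List C) (f : B → C → Carrier) →
           ∑[ xs ] (λ x → ∑[ ys ] (f x)) ≈ ∑[ ys ] (λ y → ∑[ xs ] (λ x → f x y))
  ∑-swap []       ys f = sym (∑-zero ys (λ _ → refl))
  ∑-swap (x ∷ xs) ys f = trans (+-cong refl (∑-swap xs ys f)) (sym (∑-+ ys (f x) _))

  ∑-filter : ∀ {a p} {B : Set a} {P : B → Set p} (P? : Decidable P) (xs : List B) (f : B → Carrier) →
             ∑[ filter P? xs ] f ≈ ∑[ xs ] (λ b → if does (P? b) then f b else 0#)
  ∑-filter P? []       f = refl
  ∑-filter P? (x ∷ xs) f with does (P? x)
  ... | false = trans (∑-filter P? xs f) (sym (+-identityˡ _))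
  ... | true  = +-cong refl (∑-filter P? xs f)

  ∑-allVecs-suc : ∀ {a} {B : Set a} (u w : B) (m : ℕ) (f : Vec B (suc m) → Carrier) →
                  ∑[ allVecs (u ∷ w ∷ []) (suc m) ] f
                  ≈ ∑[ allVecs (u ∷ w ∷ []) m ] (f ∘ (u ∷_)) + ∑[ allVecs (u ∷ w ∷ []) m ] (f ∘ (w ∷_))
  ∑-allVecs-suc {B = B} u w m f = begin
    ∑[ map (u ∷_) vs ++ (map (w ∷_) vs ++ []) ] f  ≈⟨ ∑-++ (map (u ∷_) vs) _ f ⟩
    ∑[ map (u ∷_) vs ] f + ∑[ map (w ∷_) vs ++ [] ] f
      ≈⟨ +-cong refl (trans (∑-++ (map (w ∷_) vs) [] f) (+-identityʳ _)) ⟩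
    ∑[ map (u ∷_) vs ] f + ∑[ map (w ∷_) vs ] f      ≈⟨ +-cong (∑-map _ vs f) (∑-map _ vs f) ⟩
    ∑[ vs ] (f ∘ (u ∷_)) + ∑[ vs ] (f ∘ (w ∷_))      ∎
    where
    open SetoidReasoning setoid
    vs : List (Vec B m)
    vs = allVecs (u ∷ w ∷ []) m

  Π : (m : ℕ) → (Fin m → Carrier) → Carrier
  Π = Π-Fin R

  ∏∈ : ∀ {m} → Subset m → (Fin m → Carrier) → Carrier
  ∏∈ {m} S F = Π m (λ i → if lookup S i then F i else 1#)

  Π-*-const : ∀ m (g : Fin m → Carrier) (h : Carrier) → Π m (λ i → g i * h) ≈ Π m g * pow R h m
  Π-*-const zero    g h = sym (*-identityˡ 1#)
  Π-*-const (suc m) g h = trans (*-cong refl (Π-*-const m (g ∘ suc) h)) (*-interchange _ _ _ _)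

  Π-1+-expand : ∀ m (a : Fin m → Carrier) → Π m (λ i → 1# + a i) ≈ ∑[ allSubsets m ] (λ S → ∏∈ S a)
  Π-1+-expand zero    a = sym (+-identityʳ 1#)
  Π-1+-expand (suc m) a = begin
    (1# + a zero) * Π m (λ i → 1# + a (suc i))
      ≈⟨ *-cong refl (Π-1+-expand m (a ∘ suc)) ⟩
    (1# + a zero) * ∑[ subsets ] (λ S → ∏∈ S (a ∘ suc))
      ≈⟨ distribʳ _ _ _ ⟩
    1# * ∑[ subsets ] (λ S → ∏∈ S (a ∘ suc)) + a zero * ∑[ subsets ] (λ S → ∏∈ S (a ∘ suc))
      ≈⟨ +-cong (∑-*ˡ subsets 1# _) (∑-*ˡ subsets (a zero) _) ⟩
    ∑[ subsets ] (λ S → ∏∈ (outside ∷ S) a) + ∑[ subsets ] (λ S → ∏∈ (inside ∷ S) a)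
      ≈⟨ ∑-allVecs-suc outside inside m (λ S → ∏∈ S a) ⟨
    ∑[ allSubsets (suc m) ] (λ S → ∏∈ S a) ∎
    where
    open SetoidReasoning setoid
    subsets : List (Subset m)
    subsets = allSubsets m

  ∏∈-cong : ∀ {m} (S : Subset m) {f g : Fin m → Carrier} → (∀ i → f i ≈ g i) → ∏∈ S f ≈ ∏∈ S g
  ∏∈-cong []            f≈g = refl
  ∏∈-cong (outside ∷ S) f≈g = *-cong refl (∏∈-cong S (f≈g ∘ suc))
  ∏∈-cong (inside ∷ S)  f≈g = *-cong (f≈g zero) (∏∈-cong S (f≈g ∘ suc))

  ∏∈-1 : ∀ {m} (S : Subset m) → ∏∈ S (λ _ → 1#) ≈ 1#
  ∏∈-1 []            = refl
  ∏∈-1 (outside ∷ S) = trans (*-identityˡ _) (∏∈-1 S)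
  ∏∈-1 (inside ∷ S)  = trans (*-identityˡ _) (∏∈-1 S)

  ∏∈-* : ∀ {m} (S : Subset m) (f g : Fin m → Carrier) →
         ∏∈ S (λ i → f i * g i) ≈ ∏∈ S f * ∏∈ S g
  ∏∈-* []            f g = sym (*-identityˡ 1#)
  ∏∈-* (outside ∷ S) f g =
    trans (*-identityˡ _) (trans (∏∈-* S (f ∘ suc) (g ∘ suc))
                                  (sym (*-cong (*-identityˡ _) (*-identityˡ _))))
  ∏∈-* (inside ∷ S)  f g = trans (*-cong refl (∏∈-* S (f ∘ suc) (g ∘ suc))) (*-interchange _ _ _ _)

  ∏∈-⊥ : ∀ n (F : Fin n → Carrier) → ∏∈ (⊥ {n}) F ≈ 1#
  ∏∈-⊥ zero    F = refl
  ∏∈-⊥ (suc n) F = trans (*-identityˡ _) (∏∈-⊥ n (F ∘ suc))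

  ∏∈-insert : ∀ {n} (x : Fin n) (p : Subset n) (F : Fin n → Carrier) → x ∉ p →
              ∏∈ (insert x p) F ≈ F x * ∏∈ p F
  ∏∈-insert zero    (outside ∷ p) F _   = *-cong refl (sym (*-identityˡ _))
  ∏∈-insert zero    (inside ∷ p)  F x∉p = contradiction here x∉p
  ∏∈-insert (suc x) (b ∷ p)       F x∉p =
    trans (*-cong refl (∏∈-insert x p (F ∘ suc) (x∉p ∘ there))) (x∙yz≈y∙xz _ _ _)

  ∏∈-image : ∀ {d n} {q : Fin d → Fin n} → Injective _≡_ _≡_ q → (S : Subset d) (F : Fin n → Carrier) →
             ∏∈ S (F ∘ q) ≈ ∏∈ (image q S) F
  ∏∈-image {n = n} _ [] F = sym (∏∈-⊥ n F)
  ∏∈-image q-inj (outside ∷ S) F = trans (*-identityˡ _) (∏∈-image (injective-∘suc q-inj) S F)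
  ∏∈-image q-inj (inside ∷ S)  F =
    trans (*-cong refl (∏∈-image (injective-∘suc q-inj) S F))
          (sym (∏∈-insert _ _ F (head∉image-tail q-inj S)))

module Fourier {c ℓ} (R : CommutativeRing c ℓ) (half : CommutativeRing.Carrier R)
               (half+half≈1 : CommutativeRing._≈_ R (CommutativeRing._+_ R half half) (CommutativeRing.1# R))
               where

  open CommutativeRing R hiding (zero)
  open RingProperties ring using (-1*x≈-x; -‿involutive)
  open CommutativeSemigroupProperties *-commutativeSemigroup using (x∙yz≈y∙xz; x∙yz≈xz∙y)
    renaming (interchange to *-interchange)
  open SumsAndProducts R
  open SetoidReasoning setoid

  sgn-square : ∀ s → sgn R s * sgn R s ≈ 1#
  sgn-square Sign.+ = *-identityˡ 1#
  sgn-square Sign.- = trans (-1*x≈-x (- 1#)) (-‿involutive 1#)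

  χ-square : ∀ {n} (U : Subset n) (y : Vec Sign n) → χ R U y * χ R U y ≈ 1#
  χ-square U y = begin
    χ R U y * χ R U y                                    ≈⟨ ∏∈-* U _ _ ⟨
    ∏∈ U (λ i → sgn R (lookup y i) * sgn R (lookup y i)) ≈⟨ ∏∈-cong U (sgn-square ∘ lookup y) ⟩
    ∏∈ U (λ _ → 1#)                                      ≈⟨ ∏∈-1 U ⟩
    1#                                                   ∎

  pow-half-∑-1 : ∀ n → pow R half n * ∑[ allSigns n ] (λ _ → 1#) ≈ 1#
  pow-half-∑-1 zero    = trans (*-identityˡ _) (+-identityʳ 1#)
  pow-half-∑-1 (suc n) = begin
    (half * h) * ∑[ allSigns (suc n) ] (λ _ → 1#) ≈⟨ *-cong refl (∑-allVecs-suc Sign.- Sign.+ n _) ⟩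
    (half * h) * (s + s)                          ≈⟨ *-assoc _ _ _ ⟩
    half * (h * (s + s))                          ≈⟨ *-cong refl (distribˡ h s s) ⟩
    half * (h * s + h * s)                        ≈⟨ *-cong refl (+-cong (pow-half-∑-1 n) (pow-half-∑-1 n)) ⟩
    half * (1# + 1#)                              ≈⟨ distribˡ half 1# 1# ⟩
    half * 1# + half * 1#                         ≈⟨ +-cong (*-identityʳ half) (*-identityʳ half) ⟩
    half + half                                   ≈⟨ half+half≈1 ⟩
    1#                                            ∎
    where
    h s : Carrier
    h = pow R half n
    s = ∑[ allSigns n ] (λ _ → 1#)

  χ-head-product : Bool → Bool → Sign → Carrier
  χ-head-product u w s = (if u then sgn R s else 1#) * (if w then sgn R s else 1#)

  ∑-χ*χ-cons : ∀ {n} (u w : Bool) (U S : Subset n) →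
               ∑[ allSigns (suc n) ] (λ y → χ R (u ∷ U) y * χ R (w ∷ S) y)
               ≈ (χ-head-product u w Sign.- + χ-head-product u w Sign.+) * ∑[ allSigns n ] (λ y → χ R U y * χ R S y)
  ∑-χ*χ-cons {n} u w U S = begin
    ∑[ allSigns (suc n) ] (λ y → χ R (u ∷ U) y * χ R (w ∷ S) y)
      ≈⟨ ∑-allVecs-suc Sign.- Sign.+ n _ ⟩
    ∑[ allSigns n ] (term Sign.-) + ∑[ allSigns n ] (term Sign.+)
      ≈⟨ +-cong (∑-cong (allSigns n) (λ _ → *-interchange _ _ _ _))
                (∑-cong (allSigns n) (λ _ → *-interchange _ _ _ _)) ⟩
    ∑[ allSigns n ] (λ y → χ-head-product u w Sign.- * χχ y) + ∑[ allSigns n ] (λ y → χ-head-product u w Sign.+ * χχ y)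
      ≈⟨ +-cong (∑-*ˡ (allSigns n) _ χχ) (∑-*ˡ (allSigns n) _ χχ) ⟨
    χ-head-product u w Sign.- * ∑[ allSigns n ] χχ + χ-head-product u w Sign.+ * ∑[ allSigns n ] χχ
      ≈⟨ distribʳ _ _ _ ⟨
    (χ-head-product u w Sign.- + χ-head-product u w Sign.+) * ∑[ allSigns n ] χχ ∎
    where
    term : Sign → Vec Sign n → Carrier
    term s y = χ R (u ∷ U) (s ∷ y) * χ R (w ∷ S) (s ∷ y)
    χχ : Vec Sign n → Carrier
    χχ y = χ R U y * χ R S y

  ∑-χ*χ-≢ : ∀ {n} (U S : Subset n) → U ≢ S → ∑[ allSigns n ] (λ y → χ R U y * χ R S y) ≈ 0#
  ∑-χ*χ-≢ [] [] U≢S = contradiction ≡.refl U≢S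
  ∑-χ*χ-≢ (outside ∷ U) (outside ∷ S) U≢S =
    trans (∑-χ*χ-cons outside outside U S)
          (trans (*-cong refl (∑-χ*χ-≢ U S (U≢S ∘ ≡.cong (outside ∷_)))) (zeroʳ _))
  ∑-χ*χ-≢ (inside ∷ U) (inside ∷ S) U≢S =
    trans (∑-χ*χ-cons inside inside U S)
          (trans (*-cong refl (∑-χ*χ-≢ U S (U≢S ∘ ≡.cong (inside ∷_)))) (zeroʳ _))
  ∑-χ*χ-≢ (outside ∷ U) (inside ∷ S) _ =
    trans (∑-χ*χ-cons outside inside U S)
          (trans (*-cong (trans (+-cong (*-identityˡ _) (*-identityˡ _)) (-‿inverseˡ 1#)) refl) (zeroˡ _))
  ∑-χ*χ-≢ (inside ∷ U) (outside ∷ S) _ =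
    trans (∑-χ*χ-cons inside outside U S)
          (trans (*-cong (trans (+-cong (*-identityʳ _) (*-identityʳ _)) (-‿inverseˡ 1#)) refl) (zeroˡ _))

  coeff-χ-self : ∀ {n} (U : Subset n) → coeff R half (χ R U) U ≈ 1#
  coeff-χ-self {n} U =
    trans (*-cong refl (∑-cong (allSigns n) (χ-square U))) (pow-half-∑-1 n)

  coeff-χ-≢ : ∀ {n} (U S : Subset n) → U ≢ S → coeff R half (χ R U) S ≈ 0#
  coeff-χ-≢ U S U≢S = trans (*-cong refl (∑-χ*χ-≢ U S U≢S)) (zeroʳ _)

  ∑-allSubsets-single : ∀ n (U : Subset n) (g : Subset n → Carrier) →
                        (∀ S → S ≢ U → g S ≈ 0#) → ∑[ allSubsets n ] g ≈ g U
  ∑-allSubsets-single zero [] g _ = +-identityʳ _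
  ∑-allSubsets-single (suc n) (outside ∷ U) g g≈0 =
    trans (∑-allVecs-suc outside inside n g)
          (trans (+-cong (∑-allSubsets-single n U (g ∘ (outside ∷_)) (λ S S≢U → g≈0 _ (S≢U ∘ ∷-injectiveʳ)))
                         (∑-zero (allSubsets n) (λ S → g≈0 _ λ ())))
                 (+-identityʳ _))
  ∑-allSubsets-single (suc n) (inside ∷ U) g g≈0 =
    trans (∑-allVecs-suc outside inside n g)
          (trans (+-cong (∑-zero (allSubsets n) (λ S → g≈0 _ λ ()))
                         (∑-allSubsets-single n U (g ∘ (inside ∷_)) (λ S S≢U → g≈0 _ (S≢U ∘ ∷-injectiveʳ))))
                 (+-identityˡ _))

  coeff-cong : ∀ {n} {φ ψ : Cube R n} → (∀ y → φ y ≈ ψ y) → ∀ S → coeff R half φ S ≈ coeff R half ψ S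
  coeff-cong {n} φ≈ψ S = *-cong refl (∑-cong (allSigns n) (λ y → *-cong (φ≈ψ y) refl))

  coeff-∑ : ∀ {n a} {B : Set a} (xs : List B) (ψ : B → Cube R n) S →
            coeff R half (λ y → ∑[ xs ] (λ b → ψ b y)) S ≈ ∑[ xs ] (λ b → coeff R half (ψ b) S)
  coeff-∑ {n} xs ψ S = begin
    pow R half n * ∑[ allSigns n ] (λ y → ∑[ xs ] (λ b → ψ b y) * χ R S y)
      ≈⟨ *-cong refl (∑-cong (allSigns n) (λ y → ∑-*ʳ xs (χ R S y) _)) ⟩
    pow R half n * ∑[ allSigns n ] (λ y → ∑[ xs ] (λ b → ψ b y * χ R S y))
      ≈⟨ *-cong refl (∑-swap (allSigns n) xs _) ⟩
    pow R half n * ∑[ xs ] (λ b → ∑[ allSigns n ] (λ y → ψ b y * χ R S y))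
      ≈⟨ ∑-*ˡ xs (pow R half n) _ ⟩
    ∑[ xs ] (λ b → coeff R half (ψ b) S) ∎

  coeff-* : ∀ {n} (α : Carrier) (φ : Cube R n) S →
            coeff R half (λ y → α * φ y) S ≈ α * coeff R half φ S
  coeff-* {n} α φ S = begin
    pow R half n * ∑[ allSigns n ] (λ y → (α * φ y) * χ R S y)
      ≈⟨ *-cong refl (∑-cong (allSigns n) (λ y → *-assoc α (φ y) _)) ⟩
    pow R half n * ∑[ allSigns n ] (λ y → α * (φ y * χ R S y))
      ≈⟨ *-cong refl (∑-*ˡ (allSigns n) α _) ⟨
    pow R half n * (α * ∑[ allSigns n ] (λ y → φ y * χ R S y))
      ≈⟨ x∙yz≈y∙xz _ _ _ ⟩
    α * coeff R half φ S ∎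

  L-cong : ∀ {n} k {φ ψ : Cube R n} → (∀ y → φ y ≈ ψ y) → ∀ x → L R half k φ x ≈ L R half k ψ x
  L-cong {n} k φ≈ψ x = ∑-cong (P n k) (λ S → *-cong (coeff-cong φ≈ψ S) refl)

  L-∑ : ∀ {n a} {B : Set a} k (xs : List B) (ψ : B → Cube R n) x →
        L R half k (λ y → ∑[ xs ] (λ b → ψ b y)) x ≈ ∑[ xs ] (λ b → L R half k (ψ b) x)
  L-∑ {n} k xs ψ x = begin
    ∑[ P n k ] (λ S → coeff R half (λ y → ∑[ xs ] (λ b → ψ b y)) S * χ R S x)
      ≈⟨ ∑-cong (P n k) (λ S → trans (*-cong (coeff-∑ xs ψ S) refl) (∑-*ʳ xs _ _)) ⟩
    ∑[ P n k ] (λ S → ∑[ xs ] (λ b → coeff R half (ψ b) S * χ R S x))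
      ≈⟨ ∑-swap (P n k) xs _ ⟩
    ∑[ xs ] (λ b → L R half k (ψ b) x) ∎

  L-* : ∀ {n} k (α : Carrier) (φ : Cube R n) x → L R half k (λ y → α * φ y) x ≈ α * L R half k φ x
  L-* {n} k α φ x = begin
    ∑[ P n k ] (λ S → coeff R half (λ y → α * φ y) S * χ R S x)
      ≈⟨ ∑-cong (P n k) (λ S → trans (*-cong (coeff-* α φ S) refl) (*-assoc _ _ _)) ⟩
    ∑[ P n k ] (λ S → α * (coeff R half φ S * χ R S x))
      ≈⟨ ∑-*ˡ (P n k) α _ ⟨
    α * L R half k φ x ∎

  L-χ : ∀ {n} k (U : Subset n) x → L R half k (χ R U) x ≈ (if does (∣ U ∣ ≟ k) then χ R U x else 0#)
  L-χ {n} k U x = begin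
    ∑[ P n k ] (λ S → coeff R half (χ R U) S * χ R S x)
      ≈⟨ ∑-filter (λ S → ∣ S ∣ ≟ k) (allSubsets n) _ ⟩
    ∑[ allSubsets n ] term
      ≈⟨ ∑-allSubsets-single n U term (λ S S≢U → term-≢ S (≡.≢-sym S≢U)) ⟩
    term U
      ≈⟨ if-cong (does (∣ U ∣ ≟ k)) (trans (*-cong (coeff-χ-self U) refl) (*-identityˡ _)) ⟩
    (if does (∣ U ∣ ≟ k) then χ R U x else 0#) ∎
    where
    term : Subset n → Carrier
    term S = if does (∣ S ∣ ≟ k) then coeff R half (χ R U) S * χ R S x else 0#
    if-cong : ∀ b {y z} → y ≈ z → (if b then y else 0#) ≈ (if b then z else 0#)
    if-cong true  y≈z = y≈z
    if-cong false _   = refl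
    term-≢ : ∀ S → U ≢ S → term S ≈ 0#
    term-≢ S U≢S = trans (if-cong (does (∣ S ∣ ≟ k)) (trans (*-cong (coeff-χ-≢ U S U≢S) refl) (zeroˡ _)))
                         (if-0 (does (∣ S ∣ ≟ k)))
      where
      if-0 : ∀ b → (if b then 0# else 0#) ≈ 0#
      if-0 true  = refl
      if-0 false = refl

  *-if-0 : ∀ b {α y z} → α * y ≈ z → α * (if b then y else 0#) ≈ (if b then z else 0#)
  *-if-0 true  αy≈z = αy≈z
  *-if-0 false _    = zeroʳ _

  monomial : ∀ {d n} → (Fin d → Carrier) → (Fin d → Fin n) → Subset d → Cube R n
  monomial a q S y = ∏∈ S (λ i → a i * sgn R (lookup y (q i)))

  monomial≈χ-image : ∀ {d n} {q : Fin d → Fin n} → Injective _≡_ _≡_ q →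
                     ∀ a S y → monomial a q S y ≈ ∏∈ S a * χ R (image q S) y
  monomial≈χ-image q-inj a S y =
    trans (∏∈-* S a _) (*-cong refl (∏∈-image q-inj S (sgn R ∘ lookup y)))

  L-monomial : ∀ {d n} {q : Fin d → Fin n} → Injective _≡_ _≡_ q → ∀ k a S x →
               L R half k (monomial a q S) x ≈ (if does (∣ S ∣ ≟ k) then monomial a q S x else 0#)
  L-monomial {q = q} q-inj k a S x = begin
    L R half k (monomial a q S) x
      ≈⟨ L-cong k (monomial≈χ-image q-inj a S) x ⟩
    L R half k (λ y → ∏∈ S a * χ R (image q S) y) x
      ≈⟨ L-* k (∏∈ S a) _ x ⟩
    ∏∈ S a * L R half k (χ R (image q S)) x
      ≈⟨ *-cong refl (L-χ k (image q S) x) ⟩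
    ∏∈ S a * (if does (∣ image q S ∣ ≟ k) then χ R (image q S) x else 0#)
      ≡⟨ ≡.cong (λ m → ∏∈ S a * (if does (m ≟ k) then χ R (image q S) x else 0#)) (∣image∣ q-inj S) ⟩
    ∏∈ S a * (if does (∣ S ∣ ≟ k) then χ R (image q S) x else 0#)
      ≈⟨ *-if-0 (does (∣ S ∣ ≟ k)) (sym (monomial≈χ-image q-inj a S x)) ⟩
    (if does (∣ S ∣ ≟ k) then monomial a q S x else 0#) ∎

  eval≈∑-monomials : ∀ {n d} (T : DTree Carrier n d) y →
    eval R half T y ≈ ∑[ allSigns d ] (λ v → ∑[ allSubsets d ] (λ S →
                        (label T v * pow R half d) * monomial (sgn R ∘ lookup v) (query T v) S y))
  eval≈∑-monomials {d = d} T y = ∑-cong (allSigns d) λ v → begin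
    label T v * Π d (λ i → (1# + a v i) * half)
      ≈⟨ *-cong refl (Π-*-const d _ half) ⟩
    label T v * (Π d (λ i → 1# + a v i) * pow R half d)
      ≈⟨ x∙yz≈xz∙y _ _ _ ⟩
    (label T v * pow R half d) * Π d (λ i → 1# + a v i)
      ≈⟨ *-cong refl (Π-1+-expand d (a v)) ⟩
    (label T v * pow R half d) * ∑[ allSubsets d ] (λ S → ∏∈ S (a v))
      ≈⟨ ∑-*ˡ (allSubsets d) _ _ ⟩
    ∑[ allSubsets d ] (λ S → (label T v * pow R half d) * ∏∈ S (a v)) ∎
    where
    a : Vec Sign d → Fin d → Carrier
    a v i = sgn R (lookup v i) * sgn R (lookup y (query T v i))

lemma4p2 : ∀ {c ℓ} (R : CommutativeRing c ℓ) (half : CommutativeRing.Carrier R)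
           → CommutativeRing._≈_ R (CommutativeRing._+_ R half half) (CommutativeRing.1# R)
           → (n d : ℕ) (T : DTree (CommutativeRing.Carrier R) n d) → Distinct T
           → (k : ℕ) → k ≤ n → (x : Vec Sign n)
           → CommutativeRing._≈_ R (L R half k (eval R half T) x) (restrict R half T (P d k) x)
lemma4p2 R half half+half≈1 n d T distinct k _ x = begin
  L R half k (eval R half T) x
    ≈⟨ L-cong k (eval≈∑-monomials T) x ⟩
  L R half k (λ y → ∑[ allSigns d ] (λ v → ∑[ allSubsets d ] (λ S → w v * m v S y))) x
    ≈⟨ trans (L-∑ k (allSigns d) _ x) (∑-cong (allSigns d) λ v →
         trans (L-∑ k (allSubsets d) _ x) (∑-cong (allSubsets d) λ S → L-* k (w v) (m v S) x)) ⟩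
  ∑[ allSigns d ] (λ v → ∑[ allSubsets d ] (λ S → w v * L R half k (m v S) x))
    ≈⟨ ∑-cong (allSigns d) (λ v → ∑-cong (allSubsets d) λ S →
         trans (*-cong refl (L-monomial (λ {i} {j} → distinct v i j) k _ S x))
               (*-if-0 (does (∣ S ∣ ≟ k)) refl)) ⟩
  ∑[ allSigns d ] (λ v → ∑[ allSubsets d ] (λ S → if does (∣ S ∣ ≟ k) then w v * m v S x else 0#))
    ≈⟨ ∑-cong (allSigns d) (λ v → sym (∑-filter (λ S → ∣ S ∣ ≟ k) (allSubsets d) _)) ⟩
  ∑[ allSigns d ] (λ v → ∑[ P d k ] (λ S → w v * m v S x))
    ≈⟨ ∑-swap (allSigns d) (P d k) _ ⟩
  restrict R half T (P d k) x ∎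
  where
  open CommutativeRing R using (Carrier; _*_; 0#; *-cong; refl; trans; sym; setoid)
  open SumsAndProducts R
  open Fourier R half half+half≈1
  open SetoidReasoning setoid
  w : Vec Sign d → Carrier
  w v = label T v * pow R half d
  m : Vec Sign d → Subset d → Cube R n
  m v = monomial (sgn R ∘ lookup v) (query T v)
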